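{- Let $H$ be a graph of order $n$ and maximum degree $\Delta$, and let $r\ge 1$ be an integer. (i) If $\Delta=n-1$, then $\dim_s(K_r+H)=\dim_s(H)+r$. (ii) If $\Delta\le n-2$ and $H$ has diameter two, then $\dim_s(K_r+H)=\dim_s(H)+r-1$. (iii) If $H$ is not connected or its diameter is greater than two, then $\dim_s(K_r+H)=\dim_s(K_1+H)+r-1$.
   Context: All graphs are finite and simple. $K_r$ is the complete graph on $r$ vertices; the join $A+B$ is obtained from disjoint copies of $A$ and $B$ by joining every vertex of $A$ to every vertex of $B$. For a connected graph $X$, $I_X[u,v]$ is the set of vertices on some shortest $u$–$v$ path; $w$ strongly resolves $u,v$ if $v\in I_X[u,w]$ or $u\in I_X[v,w]$; a strong resolving set is a set $S$ such that every two distinct vertices are strongly resolved by some vertex of $S$; $\dim_s(X)$ is the minimum size of a strong resolving set. -}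

module Defs where

open import Data.Nat using (ℕ; zero; suc; _+_; _≤_; _⊔_)
open import Data.Fin using (Fin; splitAt)
open import Data.Fin.Subset using (Subset; _∈_; ∣_∣)
open import Data.Bool using (Bool; true; false; if_then_else_)
open import Data.List using (List; foldr; map; length; filter)
open import Data.List.Base using (allFin)
open import Data.Sum using (_⊎_; inj₁; inj₂)
open import Data.Product using (Σ; _×_; ∃; ∃-syntax; _,_)
open import Relation.Binary.PropositionalEquality using (_≡_; _≢_)
open import Relation.Nullary using (¬_)
open import Data.Bool.Properties using (T?)
open import Data.Bool using (T)

record Graph (n : ℕ) : Set where
  field
    adj   : Fin n → Fin n → Bool
    adj-sym : ∀ u v → adj u v ≡ adj v u
    irref : ∀ u → adj u u ≡ false
open Graph public

degree : ∀ {n} → Graph n → Fin n → ℕ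
degree {n} G v = length (filter (λ w → T? (adj G v w)) (allFin n))

maxDegree : ∀ {n} → Graph n → ℕ
maxDegree {n} G = foldr _⊔_ 0 (map (degree G) (allFin n))

data Walk {n : ℕ} (G : Graph n) : Fin n → Fin n → Set where
  [_]  : (u : Fin n) → Walk G u u
  _∷⟨_⟩_ : (u : Fin n) {w v : Fin n} → adj G u w ≡ true → Walk G w v → Walk G u v

len : ∀ {n} {G : Graph n} {u v} → Walk G u v → ℕ
len [ _ ] = 0
len (_ ∷⟨ _ ⟩ p) = suc (len p)

data _onWalk_ {n : ℕ} {G : Graph n} (x : Fin n) : ∀ {u v} → Walk G u v → Set where
  here-nil  : x onWalk [ x ]
  here-cons : ∀ {w v} (e : adj G x w ≡ true) (p : Walk G w v) → x onWalk (x ∷⟨ e ⟩ p)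
  there     : ∀ {u w v} (e : adj G u w ≡ true) (p : Walk G w v) → x onWalk p → x onWalk (u ∷⟨ e ⟩ p)

IsShortest : ∀ {n} (G : Graph n) {u v : Fin n} → Walk G u v → Set
IsShortest G {u} {v} p = ∀ (q : Walk G u v) → len p ≤ len q

Connected : ∀ {n} → Graph n → Set
Connected {n} G = ∀ (u v : Fin n) → Walk G u v

Dist : ∀ {n} (G : Graph n) → Fin n → Fin n → ℕ → Set
Dist G u v k = Σ (Walk G u v) λ p → IsShortest G p × len p ≡ k

HasDiameter : ∀ {n} → Graph n → ℕ → Set
HasDiameter {n} G d =
  Connected G × (∀ (u v : Fin n) (k : ℕ) → Dist G u v k → k ≤ d) × (∃[ u ] ∃[ v ] Dist G u v d)

Interval : ∀ {n} (G : Graph n) → Fin n → Fin n → Fin n → Set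
Interval G u v w = Σ (Walk G u v) λ p → IsShortest G p × (w onWalk p)

StronglyResolves : ∀ {n} (G : Graph n) → Fin n → Fin n → Fin n → Set
StronglyResolves G w u v = Interval G u w v ⊎ Interval G v w u

IsStrongResolvingSet : ∀ {n} → Graph n → Subset n → Set
IsStrongResolvingSet {n} G S =
  ∀ (u v : Fin n) → u ≢ v → ∃[ w ] (w ∈ S × StronglyResolves G w u v)

StrongMetricDim : ∀ {n} → Graph n → ℕ → Set
StrongMetricDim {n} G k =
  (∃[ S ] (IsStrongResolvingSet G S × ∣ S ∣ ≡ k)) ×
  (∀ (S : Subset n) → IsStrongResolvingSet G S → k ≤ ∣ S ∣)

complete : (r : ℕ) → Graph r
complete r = record { adj = λ u v → not≡ u v ; adj-sym = sym' ; irref = irr }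
  where
  open import Data.Fin using (_≟_)
  open import Relation.Nullary using (yes; no)
  open import Relation.Binary.PropositionalEquality using (refl; sym)
  not≡ : Fin r → Fin r → Bool
  not≡ u v with u ≟ v
  ... | yes _ = false
  ... | no _ = true
  sym' : ∀ u v → not≡ u v ≡ not≡ v u
  sym' u v with u ≟ v | v ≟ u
  ... | yes _ | yes _ = refl
  ... | no _ | no _ = refl
  ... | yes e | no ne = Data.Empty.⊥-elim (ne (sym e)) where import Data.Empty
  ... | no ne | yes e = Data.Empty.⊥-elim (ne (sym e)) where import Data.Empty
  irr : ∀ u → not≡ u u ≡ false
  irr u with u ≟ u
  ... | yes _ = refl
  ... | no ne = Data.Empty.⊥-elim (ne refl) where import Data.Empty

-- Join A + B on Fin (m + n): first m vertices from A, last n from B.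
joinAdj : ∀ {m n} → Graph m → Graph n → Fin (m + n) → Fin (m + n) → Bool
joinAdj {m} A B x y with splitAt m x | splitAt m y
... | inj₁ a | inj₁ b = adj A a b
... | inj₂ a | inj₂ b = adj B a b
... | inj₁ _ | inj₂ _ = true
... | inj₂ _ | inj₁ _ = true

_⊕_ : ∀ {m n} → Graph m → Graph n → Graph (m + n)
_⊕_ {m} A B = record { adj = joinAdj A B ; adj-sym = s ; irref = i }
  where
  open import Relation.Binary.PropositionalEquality using (refl)
  s : ∀ x y → joinAdj A B x y ≡ joinAdj A B y x
  s x y with splitAt m x | splitAt m y
  ... | inj₁ a | inj₁ b = adj-sym A a b
  ... | inj₂ a | inj₂ b = adj-sym B a b
  ... | inj₁ _ | inj₂ _ = refl
  ... | inj₂ _ | inj₁ _ = refl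
  i : ∀ x → joinAdj A B x x ≡ false
  i x with splitAt m x
  ... | inj₁ a = irref A a
  ... | inj₂ b = irref B b

module Submission where

-- K_r + H with r ≥ 1 has diameter at most 2, and in a graph of diameter at most 2 a vertex w
-- strongly resolves u ≠ v iff w ∈ {u, v}, or u ∼ v and w lies beyond one of them on a geodesic
-- u – v – w.  In the join this forces a strong resolving set to be S_C ∪ S_H where S_H ⊆ V(H)
-- separates H in this local sense and S_C is the whole clique or the clique minus one vertex;
-- the latter is possible iff every vertex of H lies in S_H or has a non-neighbour in S_H.
-- Hence dim_s(K_{r+1} + H) = r + e(H) for a minimal excess e(H) independent of r, which is (iii).
-- If H has a universal vertex z, every such S_H contains z and stays separating without it, so
-- e(H) = dim_s(H) + 1; if H has diameter two and no universal vertex, every separating set of H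
-- has the non-neighbour property, so e(H) = dim_s(H).

open import Defs
open import Data.Nat using (ℕ; zero; suc; _+_; _∸_; _≤_; _<_; z≤n; s≤s)
import Data.Nat.Properties as ℕ
open import Data.Nat.Properties
  using (≤-refl; ≤-trans; ≤-reflexive; n≤1+n; +-suc; +-comm; +-monoʳ-≤; +-cancelˡ-≤;
         m+n∸m≡n; m∸[m∸n]≡n; ∸-monoʳ-≤; ⊔-sel; m⊔n≤o⇒m≤o; m⊔n≤o⇒n≤o)
open import Data.Bool using (true; false; T)
import Data.Bool.Properties as Bool
open import Data.Bool.Properties using (T?)
open import Data.Fin using (Fin; zero; suc; _≟_; _↑ˡ_; _↑ʳ_; splitAt; join; fromℕ<)
open import Data.Fin.Properties
  using (any?; all?; ¬∀⟶∃¬; splitAt-↑ˡ; splitAt-↑ʳ; join-splitAt; ↑ˡ-injective; ↑ʳ-injective)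
open import Data.Fin.Subset using (Subset; _∈_; _∉_; inside; outside; ∣_∣; ⊤; ∁; ⁅_⁆; _-_)
open import Data.Fin.Subset.Properties
  using (_∈?_; ∈⊤; ⊆-antisym; ∣⊤∣≡n; ∣∁p∣≡n∸∣p∣; ∣⁅x⁆∣≡1; x∈⁅x⁆; x∈⁅y⁆⇒x≡y; x∉p⇒x∈∁p; x∈∁p⇒x∉p;
         x∈p∧x≢y⇒x∈p-y; x∈p⇒∣p-x∣<∣p∣)
open import Data.List using (List; []; _∷_; length; filter; map; allFin)
open import Data.List.Properties using (length-tabulate; foldr-forcesᵇ)
import Data.List.Membership.Propositional as List
open import Data.List.Membership.Propositional.Properties
  using (∈-filter⁺; ∈-filter⁻; ∈-allFin; ∈-map⁻; foldr-selective)
open import Data.List.Relation.Unary.Any using (here; there)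
import Data.List.Relation.Unary.All as All
import Data.List.Relation.Unary.All.Properties as All
open import Data.List.Relation.Unary.All using (_∷_)
open import Data.List.Relation.Unary.AllPairs using (_∷_)
open import Data.List.Relation.Unary.Unique.Propositional using (Unique)
import Data.List.Relation.Unary.Unique.Propositional.Properties as Unique
open import Data.List.Relation.Ternary.Interleaving.Properties using (interleave-length)
import Data.List.Relation.Ternary.Interleaving.Propositional.Properties as Interleaving
open import Data.Vec using ([]; _∷_; _++_)
import Data.Vec as Vec
open import Data.Vec.Properties using (lookup-++ˡ; lookup-++ʳ; []=⇒lookup; lookup⇒[]=)
open import Data.Sum using (_⊎_; inj₁; inj₂; swap)
import Data.Sum as Sum
open import Data.Product using (Σ; _×_; ∃-syntax; _,_; proj₁; proj₂)
open import Function using (_∘_)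
open import Relation.Nullary using (¬_; Dec; yes; no; ¬?; contradiction)
open import Relation.Nullary.Decidable using (_×-dec_)
open import Relation.Binary.PropositionalEquality
  using (_≡_; _≢_; refl; sym; trans; cong; subst; subst₂; module ≡-Reasoning)

true≢false : true ≢ false
true≢false ()

∃-least : (P : ℕ → Set) → (∀ j → Dec (P j)) → ∀ m → P m → ∃[ k ] (P k × ∀ j → P j → k ≤ j)
∃-least P P? zero p₀ = 0 , p₀ , λ _ _ → z≤n
∃-least P P? (suc m) pₘ with P? 0
... | yes p₀ = 0 , p₀ , λ _ _ → z≤n
... | no ¬p₀ with ∃-least (P ∘ suc) (P? ∘ suc) m pₘ
...   | k , pₖ , minimal = suc k , pₖ , λ { zero p₀ → contradiction p₀ ¬p₀ ; (suc j) pⱼ → s≤s (minimal j pⱼ) }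

inhabited⇒1≤order : ∀ {k} → Fin k → 1 ≤ k
inhabited⇒1≤order {suc _} _ = s≤s z≤n

distinct⇒2≤order : ∀ {k} {a b : Fin k} → a ≢ b → 2 ≤ k
distinct⇒2≤order {suc zero} {zero} {zero} a≢b = contradiction refl a≢b
distinct⇒2≤order {suc (suc _)} _ = s≤s (s≤s z≤n)

distinct∈⇒2≤length : ∀ {A : Set} {x y : A} {xs : List A} → x List.∈ xs → y List.∈ xs → x ≢ y → 2 ≤ length xs
distinct∈⇒2≤length {xs = _ ∷ _ ∷ _} _ _ _ = s≤s (s≤s z≤n)
distinct∈⇒2≤length {xs = _ ∷ []} (here refl) (here refl) x≢y = contradiction refl x≢y
distinct∈⇒2≤length {xs = _ ∷ []} (here _) (there ())
distinct∈⇒2≤length {xs = _ ∷ []} (there ())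

unique⇒∃≢ : ∀ {k} {xs : List (Fin k)} → Unique xs → 2 ≤ length xs → ∀ x → ∃[ y ] (y List.∈ xs × y ≢ x)
unique⇒∃≢ {xs = a ∷ b ∷ _} ((a≢b ∷ _) ∷ _) _ x with a ≟ x
... | yes refl = b , there (here refl) , a≢b ∘ sym
... | no a≢x = a , here refl , a≢x
unique⇒∃≢ {xs = _ ∷ []} _ (s≤s ())

∈-++⁺ˡ : ∀ {r n} {p : Subset r} {q : Subset n} {c} → c ∈ p → (c ↑ˡ n) ∈ p ++ q
∈-++⁺ˡ {p = p} {q} {c} c∈p = lookup⇒[]= _ (p ++ q) (trans (lookup-++ˡ p q c) ([]=⇒lookup c∈p))

∈-++⁻ˡ : ∀ {r n} {p : Subset r} {q : Subset n} {c} → (c ↑ˡ n) ∈ p ++ q → c ∈ p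
∈-++⁻ˡ {p = p} {q} {c} c∈ = lookup⇒[]= c p (trans (sym (lookup-++ˡ p q c)) ([]=⇒lookup c∈))

∈-++⁺ʳ : ∀ {r n} {p : Subset r} {q : Subset n} {h} → h ∈ q → (r ↑ʳ h) ∈ p ++ q
∈-++⁺ʳ {p = p} {q} {h} h∈q = lookup⇒[]= _ (p ++ q) (trans (lookup-++ʳ p q h) ([]=⇒lookup h∈q))

∈-++⁻ʳ : ∀ {r n} {p : Subset r} {q : Subset n} {h} → (r ↑ʳ h) ∈ p ++ q → h ∈ q
∈-++⁻ʳ {p = p} {q} {h} h∈ = lookup⇒[]= h q (trans (sym (lookup-++ʳ p q h)) ([]=⇒lookup h∈))

∣++∣ : ∀ {r n} (p : Subset r) (q : Subset n) → ∣ p ++ q ∣ ≡ ∣ p ∣ + ∣ q ∣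
∣++∣ [] q = refl
∣++∣ (inside ∷ p) q = cong suc (∣++∣ p q)
∣++∣ (outside ∷ p) q = ∣++∣ p q

∣∁⁅x⁆∣≡n∸1 : ∀ {r} (c : Fin r) → ∣ ∁ ⁅ c ⁆ ∣ ≡ r ∸ 1
∣∁⁅x⁆∣≡n∸1 {r} c = trans (∣∁p∣≡n∸∣p∣ ⁅ c ⁆) (cong (r ∸_) (∣⁅x⁆∣≡1 c))

HitsPairs : ∀ {r} → Subset r → Set
HitsPairs {r} p = ∀ (c c′ : Fin r) → c ≢ c′ → c ∈ p ⊎ c′ ∈ p

hitsPairs⇒⊤⊎∁⁅x⁆ : ∀ {r} {p : Subset r} → HitsPairs p → p ≡ ⊤ ⊎ ∃[ c ] (c ∉ p × p ≡ ∁ ⁅ c ⁆)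
hitsPairs⇒⊤⊎∁⁅x⁆ {r} {p} hits with all? (_∈? p)
... | yes all∈p = inj₁ (⊆-antisym (λ _ → ∈⊤) (λ {c} _ → all∈p c))
... | no ¬all∈p with ¬∀⟶∃¬ r _ (_∈? p) ¬all∈p
...   | c , c∉p = inj₂ (c , c∉p , ⊆-antisym p⊆∁⁅c⁆ ∁⁅c⁆⊆p)
  where
  p⊆∁⁅c⁆ : ∀ {c′} → c′ ∈ p → c′ ∈ ∁ ⁅ c ⁆
  p⊆∁⁅c⁆ {c′} c′∈p = x∉p⇒x∈∁p λ c′∈⁅c⁆ → c∉p (subst (_∈ p) (x∈⁅y⁆⇒x≡y c c′∈⁅c⁆) c′∈p)
  ∁⁅c⁆⊆p : ∀ {c′} → c′ ∈ ∁ ⁅ c ⁆ → c′ ∈ p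
  ∁⁅c⁆⊆p {c′} c′∈∁ with hits c c′ (λ c≡c′ → x∈∁p⇒x∉p c′∈∁ (subst (_∈ ⁅ c ⁆) c≡c′ (x∈⁅x⁆ c)))
  ... | inj₁ c∈p = contradiction c∈p c∉p
  ... | inj₂ c′∈p = c′∈p

hitsPairs-∁⁅x⁆ : ∀ {r} (c : Fin r) → HitsPairs (∁ ⁅ c ⁆)
hitsPairs-∁⁅x⁆ c c₁ c₂ c₁≢c₂ with c₁ ≟ c
... | yes refl = inj₂ (x∉p⇒x∈∁p (c₁≢c₂ ∘ sym ∘ x∈⁅y⁆⇒x≡y c))
... | no c₁≢c = inj₁ (x∉p⇒x∈∁p (c₁≢c ∘ x∈⁅y⁆⇒x≡y c))

module _ {m : ℕ} (X : Graph m) where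

  Diameter≤2 : Set
  Diameter≤2 = ∀ u v → u ≢ v → adj X u v ≡ false → ∃[ w ] (adj X u w ≡ true × adj X w v ≡ true)

  Universal : Fin m → Set
  Universal z = ∀ x → x ≢ z → adj X z x ≡ true

  -- some w ∈ S extends the edge u v to a geodesic u – v – w
  Beyond : Subset m → Fin m → Fin m → Set
  Beyond S u v = ∃[ w ] (w ∈ S × adj X v w ≡ true × adj X u w ≡ false × w ≢ u)

  Separates : Subset m → Fin m → Fin m → Set
  Separates S u v = u ∈ S ⊎ v ∈ S ⊎ (adj X u v ≡ true × (Beyond S u v ⊎ Beyond S v u))

  Separating : Subset m → Set
  Separating S = ∀ u v → u ≢ v → Separates S u v

  NonNeighbourIn : Subset m → Fin m → Set
  NonNeighbourIn S h = ∃[ w ] (w ∈ S × adj X h w ≡ false × w ≢ h)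

  DominatesComplement : Subset m → Set
  DominatesComplement S = ∀ h → h ∈ S ⊎ NonNeighbourIn S h

  separates-sym : ∀ {S u v} → Separates S u v → Separates S v u
  separates-sym (inj₁ u∈S) = inj₂ (inj₁ u∈S)
  separates-sym (inj₂ (inj₁ v∈S)) = inj₁ v∈S
  separates-sym {u = u} {v} (inj₂ (inj₂ (u∼v , beyond))) = inj₂ (inj₂ (trans (adj-sym X v u) u∼v , swap beyond))

  onWalk-end : ∀ {a b} (p : Walk X a b) → b onWalk p
  onWalk-end [ _ ] = here-nil
  onWalk-end (_ ∷⟨ e ⟩ p) = there e p (onWalk-end p)

  walkOfLength? : ∀ j u v → Dec (Σ (Walk X u v) λ p → len p ≡ j)
  walkOfLength? zero u v with u ≟ v
  ... | yes refl = yes ([ u ] , refl)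
  ... | no u≢v = no λ { ([ _ ] , _) → u≢v refl ; ((_ ∷⟨ _ ⟩ _) , ()) }
  walkOfLength? (suc j) u v with any? (λ w → (adj X u w Bool.≟ true) ×-dec walkOfLength? j w v)
  ... | yes (w , e , p , refl) = yes ((u ∷⟨ e ⟩ p) , refl)
  ... | no none = no λ { ([ _ ] , ()) ; ((_ ∷⟨ e ⟩ p) , refl) → none (_ , e , p , refl) }

  shortestWalk : ∀ {u v} → Walk X u v → Σ (Walk X u v) (IsShortest X)
  shortestWalk {u} {v} p with ∃-least _ (λ j → walkOfLength? j u v) (len p) (p , refl)
  ... | _ , (q , refl) , minimal = q , λ q′ → minimal (len q′) (q′ , refl)

  path₂-isShortest : ∀ {a b c} (e₁ : adj X a b ≡ true) (e₂ : adj X b c ≡ true) → a ≢ c → adj X a c ≡ false →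
                     IsShortest X (a ∷⟨ e₁ ⟩ (b ∷⟨ e₂ ⟩ [ c ]))
  path₂-isShortest _ _ a≢c _ [ _ ] = contradiction refl a≢c
  path₂-isShortest _ _ _ a≁c (_ ∷⟨ a∼c ⟩ [ _ ]) = contradiction (trans (sym a∼c) a≁c) true≢false
  path₂-isShortest _ _ _ _ (_ ∷⟨ _ ⟩ (_ ∷⟨ _ ⟩ _)) = s≤s (s≤s z≤n)

  hasDiameter2⇒diameter≤2 : HasDiameter X 2 → Diameter≤2
  hasDiameter2⇒diameter≤2 (connected , bounded , _) u v u≢v u≁v with shortestWalk (connected u v)
  ... | q , shortest = common q (bounded u v (len q) (q , shortest , refl))
    where
    common : (q : Walk X u v) → len q ≤ 2 → ∃[ w ] (adj X u w ≡ true × adj X w v ≡ true)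
    common [ _ ] _ = contradiction refl u≢v
    common (_ ∷⟨ u∼v ⟩ [ _ ]) _ = contradiction (trans (sym u∼v) u≁v) true≢false
    common (_ ∷⟨ u∼w ⟩ (_ ∷⟨ w∼v ⟩ [ _ ])) _ = _ , u∼w , w∼v
    common (_ ∷⟨ _ ⟩ (_ ∷⟨ _ ⟩ (_ ∷⟨ _ ⟩ _))) (s≤s (s≤s ()))

  hasDiameter2⇒2≤order : HasDiameter X 2 → 2 ≤ m
  hasDiameter2⇒2≤order (_ , _ , u , v , p , shortest , len≡2) = distinct⇒2≤order u≢v
    where
    u≢v : u ≢ v
    u≢v refl with subst (_≤ 0) len≡2 (shortest [ u ])
    ... | ()

  module _ (diameter≤2 : Diameter≤2) where

    walk≤2 : ∀ a b → Σ (Walk X a b) (λ p → len p ≤ 2)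
    walk≤2 a b with a ≟ b
    ... | yes refl = [ a ] , z≤n
    ... | no a≢b with adj X a b in e
    ...   | true = (a ∷⟨ e ⟩ [ b ]) , s≤s z≤n
    ...   | false with diameter≤2 a b a≢b e
    ...     | w , a∼w , w∼b = (a ∷⟨ a∼w ⟩ (w ∷⟨ w∼b ⟩ [ b ])) , ≤-refl

    endpoint∈interval : ∀ a b → Interval X a b b
    endpoint∈interval a b with shortestWalk (proj₁ (walk≤2 a b))
    ... | p , shortest = p , shortest , onWalk-end p

    beyond⇒interval : ∀ {S u v} → adj X u v ≡ true → (beyond : Beyond S u v) → Interval X u (proj₁ beyond) v
    beyond⇒interval {u = u} u∼v (w , _ , v∼w , u≁w , w≢u) =
      (u ∷⟨ u∼v ⟩ (_ ∷⟨ v∼w ⟩ [ w ])) , path₂-isShortest u∼v v∼w (w≢u ∘ sym) u≁w , there u∼v _ (here-cons v∼w _)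

    separating⇒resolving : ∀ S → Separating S → IsStrongResolvingSet X S
    separating⇒resolving S separating u v u≢v with separating u v u≢v
    ... | inj₁ u∈S = u , u∈S , inj₂ (endpoint∈interval v u)
    ... | inj₂ (inj₁ v∈S) = v , v∈S , inj₁ (endpoint∈interval u v)
    ... | inj₂ (inj₂ (u∼v , inj₁ beyond@(w , w∈S , _))) = w , w∈S , inj₁ (beyond⇒interval u∼v beyond)
    ... | inj₂ (inj₂ (u∼v , inj₂ beyond@(w , w∈S , _))) =
          w , w∈S , inj₂ (beyond⇒interval (trans (adj-sym X v u) u∼v) beyond)

    -- every geodesic has length at most 2, so b is either its end w or its middle vertex
    interval⇒∈⊎beyond : ∀ {S a b w} → a ≢ b → w ∈ S → Interval X a w b → b ∈ S ⊎ (adj X a b ≡ true × Beyond S a b)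
    interval⇒∈⊎beyond {S} {a} {b} {w} a≢b w∈S (p , shortest , b∈p) =
      classify p shortest b∈p (≤-trans (shortest (proj₁ (walk≤2 a w))) (proj₂ (walk≤2 a w)))
      where
      classify : (p : Walk X a w) → IsShortest X p → b onWalk p → len p ≤ 2 → b ∈ S ⊎ (adj X a b ≡ true × Beyond S a b)
      classify [ _ ] _ here-nil _ = contradiction refl a≢b
      classify (_ ∷⟨ _ ⟩ _) _ (here-cons _ _) _ = contradiction refl a≢b
      classify (_ ∷⟨ _ ⟩ [ _ ]) _ (there _ _ here-nil) _ = inj₁ w∈S
      classify (_ ∷⟨ _ ⟩ (_ ∷⟨ _ ⟩ [ _ ])) _ (there _ _ (there _ _ here-nil)) _ = inj₁ w∈S
      classify (_ ∷⟨ a∼b ⟩ (_ ∷⟨ b∼w ⟩ [ _ ])) shortest (there _ _ (here-cons _ _)) _ =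
        inj₂ (a∼b , w , w∈S , b∼w , a≁w , w≢a)
        where
        a≁w : adj X a w ≡ false
        a≁w with adj X a w in a∼w
        ... | false = refl
        ... | true with shortest (a ∷⟨ a∼w ⟩ [ w ])
        ... | s≤s ()
        w≢a : w ≢ a
        w≢a refl with shortest [ a ]
        ... | ()
      classify (_ ∷⟨ _ ⟩ (_ ∷⟨ _ ⟩ (_ ∷⟨ _ ⟩ _))) _ _ (s≤s (s≤s ()))

    resolving⇒separating : ∀ S → IsStrongResolvingSet X S → Separating S
    resolving⇒separating S resolving u v u≢v with resolving u v u≢v
    ... | w , w∈S , inj₁ v∈I with interval⇒∈⊎beyond u≢v w∈S v∈I
    ...   | inj₁ v∈S = inj₂ (inj₁ v∈S)
    ...   | inj₂ (u∼v , beyond) = inj₂ (inj₂ (u∼v , inj₁ beyond))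
    resolving⇒separating S resolving u v u≢v | w , w∈S , inj₂ u∈I with interval⇒∈⊎beyond (u≢v ∘ sym) w∈S u∈I
    ...   | inj₁ u∈S = inj₁ u∈S
    ...   | inj₂ (v∼u , beyond) = separates-sym (inj₂ (inj₂ (v∼u , inj₁ beyond)))

module _ {m : ℕ} (X : Graph m) where

  nonNeighbours : Fin m → List (Fin m)
  nonNeighbours v = filter (λ w → ¬? (T? (adj X v w))) (allFin m)

  length-nonNeighbours : ∀ v → length (nonNeighbours v) ≡ m ∸ degree X v
  length-nonNeighbours v = begin
    length (nonNeighbours v)                           ≡⟨ m+n∸m≡n (degree X v) _ ⟨
    degree X v + length (nonNeighbours v) ∸ degree X v ≡⟨ cong (_∸ degree X v) partition ⟨
    m ∸ degree X v                                     ∎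
    where
    open ≡-Reasoning
    partition : m ≡ degree X v + length (nonNeighbours v)
    partition = trans (sym (length-tabulate (λ w → w)))
                      (interleave-length (Interleaving.filter⁺ (λ w → T? (adj X v w)) (allFin m)))

  ∈-nonNeighbours⁺ : ∀ {v w} → adj X v w ≡ false → w List.∈ nonNeighbours v
  ∈-nonNeighbours⁺ {v} {w} v≁w = ∈-filter⁺ (λ w → ¬? (T? (adj X v w))) (∈-allFin w) (subst T v≁w)

  ∈-nonNeighbours⁻ : ∀ {v w} → w List.∈ nonNeighbours v → adj X v w ≡ false
  ∈-nonNeighbours⁻ {v} {w} w∈ with adj X v w | proj₂ (∈-filter⁻ (λ w → ¬? (T? (adj X v w))) {xs = allFin m} w∈)
  ... | false | _ = refl
  ... | true | ¬T = contradiction _ ¬T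

  n∸1≤degree⇒universal : ∀ {z} → m ∸ 1 ≤ degree X z → Universal X z
  n∸1≤degree⇒universal {z} high x x≢z with adj X z x in z≁x
  ... | true = refl
  ... | false = contradiction (≤-trans 2≤nonNeighbours nonNeighbours≤1) λ { (s≤s ()) }
    where
    2≤nonNeighbours : 2 ≤ length (nonNeighbours z)
    2≤nonNeighbours = distinct∈⇒2≤length (∈-nonNeighbours⁺ (irref X z)) (∈-nonNeighbours⁺ z≁x) (x≢z ∘ sym)
    nonNeighbours≤1 : length (nonNeighbours z) ≤ 1
    nonNeighbours≤1 = begin
      length (nonNeighbours z) ≡⟨ length-nonNeighbours z ⟩
      m ∸ degree X z           ≤⟨ ∸-monoʳ-≤ m high ⟩
      m ∸ (m ∸ 1)              ≡⟨ m∸[m∸n]≡n (inhabited⇒1≤order z) ⟩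
      1                        ∎
      where open ℕ.≤-Reasoning

  degree≤n∸2⇒nonNeighbour : ∀ {h} → 2 ≤ m → degree X h ≤ m ∸ 2 → ∃[ w ] (w ≢ h × adj X h w ≡ false)
  degree≤n∸2⇒nonNeighbour {h} 2≤m low with unique⇒∃≢ (Unique.filter⁺ _ (Unique.allFin⁺ m)) 2≤nonNeighbours h
    where
    2≤nonNeighbours : 2 ≤ length (nonNeighbours h)
    2≤nonNeighbours = begin
      2                        ≡⟨ m∸[m∸n]≡n 2≤m ⟨
      m ∸ (m ∸ 2)              ≤⟨ ∸-monoʳ-≤ m low ⟩
      m ∸ degree X h           ≡⟨ length-nonNeighbours h ⟨
      length (nonNeighbours h) ∎
      where open ℕ.≤-Reasoning
  ... | w , w∈ , w≢h = w , w≢h , ∈-nonNeighbours⁻ w∈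

  degree≤maxDegree : ∀ v → degree X v ≤ maxDegree X
  degree≤maxDegree v = All.lookup (All.map⁻ bounded) (∈-allFin v)
    where
    bounded : All.All (_≤ maxDegree X) (map (degree X) (allFin m))
    bounded = foldr-forcesᵇ (λ a b a⊔b≤ → m⊔n≤o⇒m≤o a b a⊔b≤ , m⊔n≤o⇒n≤o a b a⊔b≤) 0 _ ≤-refl

  maxDegree-attained : Fin m → ∃[ z ] (maxDegree X ≤ degree X z)
  maxDegree-attained v with foldr-selective ⊔-sel 0 (map (degree X) (allFin m))
  ... | inj₁ max≡0 = v , subst (_≤ degree X v) (sym max≡0) z≤n
  ... | inj₂ max∈ with ∈-map⁻ (degree X) max∈
  ...   | z , _ , max≡degree = z , ≤-reflexive max≡degree

  module _ {z : Fin m} (universal : Universal X z) where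

    universal-nonNeighbour : ∀ {w} → adj X z w ≡ false → w ≡ z
    universal-nonNeighbour {w} z≁w with w ≟ z
    ... | yes w≡z = w≡z
    ... | no w≢z = contradiction (trans (sym (universal w w≢z)) z≁w) true≢false

    universal⇒diameter≤2 : Diameter≤2 X
    universal⇒diameter≤2 u v u≢v u≁v with u ≟ z | v ≟ z
    ... | yes refl | _ = contradiction (universal-nonNeighbour u≁v) (u≢v ∘ sym)
    ... | no u≢z | yes refl = contradiction (universal-nonNeighbour (trans (adj-sym X v u) u≁v)) u≢z
    ... | no u≢z | no v≢z = z , trans (adj-sym X u z) (universal u u≢z) , universal v v≢z

    nonNeighbour≢universal : ∀ {a w} → adj X a w ≡ false → w ≢ a → w ≢ z
    nonNeighbour≢universal {a} a≁w w≢a refl = w≢a (sym (universal-nonNeighbour (trans (adj-sym X z a) a≁w)))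

    ¬beyond-universal : ∀ {S v} → ¬ Beyond X S z v
    ¬beyond-universal (w , _ , _ , z≁w , w≢z) = w≢z (universal-nonNeighbour z≁w)

    dominatesComplement⇒universal∈ : ∀ {S} → DominatesComplement X S → z ∈ S
    dominatesComplement⇒universal∈ dominates with dominates z
    ... | inj₁ z∈S = z∈S
    ... | inj₂ (w , _ , z≁w , w≢z) = contradiction (universal-nonNeighbour z≁w) w≢z

    module _ {S : Subset m} (dominates : DominatesComplement X S) where

      beyond-deleteUniversal : ∀ {u v} → Beyond X S u v → Beyond X (S - z) u v
      beyond-deleteUniversal (w , w∈S , v∼w , u≁w , w≢u) =
        w , x∈p∧x≢y⇒x∈p-y w∈S (nonNeighbour≢universal u≁w w≢u) , v∼w , u≁w , w≢u

      -- in the role of z, v itself or a non-neighbour of v beyond z separates z from v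
      separates-deleteUniversal : ∀ {u v} → u ∈ S → u ≢ v → Separates X (S - z) u v
      separates-deleteUniversal {u} {v} u∈S u≢v with u ≟ z
      ... | no u≢z = inj₁ (x∈p∧x≢y⇒x∈p-y u∈S u≢z)
      ... | yes refl with dominates v
      ...   | inj₁ v∈S = inj₂ (inj₁ (x∈p∧x≢y⇒x∈p-y v∈S (u≢v ∘ sym)))
      ...   | inj₂ (w , w∈S , v≁w , w≢v) = inj₂ (inj₂ (universal v (u≢v ∘ sym) , inj₂ beyond))
        where
        w≢z : w ≢ z
        w≢z = nonNeighbour≢universal v≁w w≢v
        beyond : Beyond X (S - z) v z
        beyond = w , x∈p∧x≢y⇒x∈p-y w∈S w≢z , universal w w≢z , v≁w , w≢v

      separating-deleteUniversal : Separating X S → Separating X (S - z)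
      separating-deleteUniversal separating u v u≢v with separating u v u≢v
      ... | inj₁ u∈S = separates-deleteUniversal u∈S u≢v
      ... | inj₂ (inj₁ v∈S) = separates-sym X (separates-deleteUniversal v∈S (u≢v ∘ sym))
      ... | inj₂ (inj₂ (u∼v , beyond)) = inj₂ (inj₂ (u∼v , Sum.map beyond-deleteUniversal beyond-deleteUniversal beyond))

  separating⇒dominatesComplement : (∀ h → ∃[ w ] (w ≢ h × adj X h w ≡ false)) →
                                   ∀ {S} → Separating X S → DominatesComplement X S
  separating⇒dominatesComplement nonUniversal {S} separating h with h ∈? S
  ... | yes h∈S = inj₁ h∈S
  ... | no h∉S with nonUniversal h
  ...   | w , w≢h , h≁w with separating h w (w≢h ∘ sym)
  ...     | inj₁ h∈S = contradiction h∈S h∉S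
  ...     | inj₂ (inj₁ w∈S) = inj₂ (w , w∈S , h≁w , w≢h)
  ...     | inj₂ (inj₂ (h∼w , _)) = contradiction (trans (sym h∼w) h≁w) true≢false


complete-nonadjacent⇒≡ : ∀ {r} {c c′ : Fin r} → adj (complete r) c c′ ≡ false → c ≡ c′
complete-nonadjacent⇒≡ {c = c} {c′} c≁c′ with c ≟ c′
... | yes c≡c′ = c≡c′
complete-nonadjacent⇒≡ () | no _

module Join {n : ℕ} (H : Graph n) (r : ℕ) where

  K+H : Graph (r + n)
  K+H = complete r ⊕ H

  clique : Fin r → Fin (r + n)
  clique c = c ↑ˡ n

  inner : Fin n → Fin (r + n)
  inner h = r ↑ʳ h

  data Vertex : Fin (r + n) → Set where
    cliqueVertex : ∀ c → Vertex (clique c)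
    innerVertex  : ∀ h → Vertex (inner h)

  vertex : ∀ x → Vertex x
  vertex x = subst Vertex (join-splitAt r n x) (fromSplit (splitAt r x))
    where
    fromSplit : ∀ s → Vertex (join r n s)
    fromSplit (inj₁ c) = cliqueVertex c
    fromSplit (inj₂ h) = innerVertex h

  adj-clique-clique : ∀ c c′ → adj K+H (clique c) (clique c′) ≡ adj (complete r) c c′
  adj-clique-clique c c′ rewrite splitAt-↑ˡ r c n | splitAt-↑ˡ r c′ n = refl

  adj-clique-inner : ∀ c h → adj K+H (clique c) (inner h) ≡ true
  adj-clique-inner c h rewrite splitAt-↑ˡ r c n | splitAt-↑ʳ r n h = refl

  adj-inner-inner : ∀ h h′ → adj K+H (inner h) (inner h′) ≡ adj H h h′
  adj-inner-inner h h′ rewrite splitAt-↑ʳ r n h | splitAt-↑ʳ r n h′ = refl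

  clique≢inner : ∀ c h → clique c ≢ inner h
  clique≢inner c h c≡h with trans (sym (splitAt-↑ˡ r c n)) (trans (cong (splitAt r) c≡h) (splitAt-↑ʳ r n h))
  ... | ()

  clique-universal : ∀ c → Universal K+H (clique c)
  clique-universal c x x≢c with vertex x
  ... | innerVertex h = adj-clique-inner c h
  ... | cliqueVertex c′ with adj (complete r) c c′ in e
  ...   | true = trans (adj-clique-clique c c′) e
  ...   | false = contradiction (cong clique (sym (complete-nonadjacent⇒≡ e))) x≢c

  module _ {SC : Subset r} {SH : Subset n} where

    beyond-inner⁻ : ∀ {h v} → Beyond K+H (SC ++ SH) (inner h) v →
                    ∃[ w ] (w ∈ SH × adj K+H v (inner w) ≡ true × adj H h w ≡ false × w ≢ h)
    beyond-inner⁻ {h} (x , x∈S , v∼x , h≁x , x≢h) with vertex x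
    ... | cliqueVertex c = contradiction refl (nonNeighbour≢universal K+H (clique-universal c) h≁x x≢h)
    ... | innerVertex w = w , ∈-++⁻ʳ x∈S , v∼x , trans (sym (adj-inner-inner h w)) h≁x , x≢h ∘ cong inner

    beyond-inner⁺ : ∀ {h v w} → w ∈ SH → adj K+H v (inner w) ≡ true → adj H h w ≡ false → w ≢ h →
                    Beyond K+H (SC ++ SH) (inner h) v
    beyond-inner⁺ {h} {w = w} w∈SH v∼w h≁w w≢h =
      inner w , ∈-++⁺ʳ w∈SH , v∼w , trans (adj-inner-inner h w) h≁w , w≢h ∘ ↑ʳ-injective r w h

    separates-clique-clique⁻ : ∀ {c c′} → Separates K+H (SC ++ SH) (clique c) (clique c′) → c ∈ SC ⊎ c′ ∈ SC
    separates-clique-clique⁻ (inj₁ c∈S) = inj₁ (∈-++⁻ˡ c∈S)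
    separates-clique-clique⁻ (inj₂ (inj₁ c′∈S)) = inj₂ (∈-++⁻ˡ c′∈S)
    separates-clique-clique⁻ {c} (inj₂ (inj₂ (_ , inj₁ beyond))) =
      contradiction beyond (¬beyond-universal K+H (clique-universal c))
    separates-clique-clique⁻ {c′ = c′} (inj₂ (inj₂ (_ , inj₂ beyond))) =
      contradiction beyond (¬beyond-universal K+H (clique-universal c′))

    separates-clique-inner⁻ : ∀ {c h} → Separates K+H (SC ++ SH) (clique c) (inner h) →
                              c ∈ SC ⊎ h ∈ SH ⊎ NonNeighbourIn H SH h
    separates-clique-inner⁻ (inj₁ c∈S) = inj₁ (∈-++⁻ˡ c∈S)
    separates-clique-inner⁻ (inj₂ (inj₁ h∈S)) = inj₂ (inj₁ (∈-++⁻ʳ h∈S))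
    separates-clique-inner⁻ {c} (inj₂ (inj₂ (_ , inj₁ beyond))) =
      contradiction beyond (¬beyond-universal K+H (clique-universal c))
    separates-clique-inner⁻ (inj₂ (inj₂ (_ , inj₂ beyond))) with beyond-inner⁻ beyond
    ... | w , w∈SH , _ , h≁w , w≢h = inj₂ (inj₂ (w , w∈SH , h≁w , w≢h))

    separates-inner-inner⁻ : ∀ {u v} → Separates K+H (SC ++ SH) (inner u) (inner v) → Separates H SH u v
    separates-inner-inner⁻ (inj₁ u∈S) = inj₁ (∈-++⁻ʳ u∈S)
    separates-inner-inner⁻ (inj₂ (inj₁ v∈S)) = inj₂ (inj₁ (∈-++⁻ʳ v∈S))
    separates-inner-inner⁻ {u} {v} (inj₂ (inj₂ (u∼v , beyond))) =
      inj₂ (inj₂ (trans (sym (adj-inner-inner u v)) u∼v , Sum.map (project u v) (project v u) beyond))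
      where
      project : ∀ a b → Beyond K+H (SC ++ SH) (inner a) (inner b) → Beyond H SH a b
      project a b beyond with beyond-inner⁻ beyond
      ... | w , w∈SH , b∼w , a≁w , w≢a = w , w∈SH , trans (sym (adj-inner-inner b w)) b∼w , a≁w , w≢a

    separates-clique-clique⁺ : ∀ {c c′} → c ∈ SC ⊎ c′ ∈ SC → Separates K+H (SC ++ SH) (clique c) (clique c′)
    separates-clique-clique⁺ (inj₁ c∈SC) = inj₁ (∈-++⁺ˡ c∈SC)
    separates-clique-clique⁺ (inj₂ c′∈SC) = inj₂ (inj₁ (∈-++⁺ˡ c′∈SC))

    separates-clique-inner⁺ : ∀ {c h} → c ∈ SC ⊎ h ∈ SH ⊎ NonNeighbourIn H SH h →
                              Separates K+H (SC ++ SH) (clique c) (inner h)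
    separates-clique-inner⁺ (inj₁ c∈SC) = inj₁ (∈-++⁺ˡ c∈SC)
    separates-clique-inner⁺ (inj₂ (inj₁ h∈SH)) = inj₂ (inj₁ (∈-++⁺ʳ h∈SH))
    separates-clique-inner⁺ {c} {h} (inj₂ (inj₂ (w , w∈SH , h≁w , w≢h))) =
      inj₂ (inj₂ (adj-clique-inner c h , inj₂ (beyond-inner⁺ w∈SH (adj-clique-inner c w) h≁w w≢h)))

    separates-inner-inner⁺ : ∀ {u v} → Separates H SH u v → Separates K+H (SC ++ SH) (inner u) (inner v)
    separates-inner-inner⁺ (inj₁ u∈SH) = inj₁ (∈-++⁺ʳ u∈SH)
    separates-inner-inner⁺ (inj₂ (inj₁ v∈SH)) = inj₂ (inj₁ (∈-++⁺ʳ v∈SH))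
    separates-inner-inner⁺ {u} {v} (inj₂ (inj₂ (u∼v , beyond))) =
      inj₂ (inj₂ (trans (adj-inner-inner u v) u∼v , Sum.map (lift u v) (lift v u) beyond))
      where
      lift : ∀ a b → Beyond H SH a b → Beyond K+H (SC ++ SH) (inner a) (inner b)
      lift a b (w , w∈SH , b∼w , a≁w , w≢a) = beyond-inner⁺ w∈SH (trans (adj-inner-inner b w) b∼w) a≁w w≢a

    separating-join⁻ : Separating K+H (SC ++ SH) →
                       Separating H SH × HitsPairs SC × (∀ c → c ∉ SC → DominatesComplement H SH)
    separating-join⁻ separating = separatingH , hits , dominates
      where
      separatingH : Separating H SH
      separatingH u v u≢v = separates-inner-inner⁻ (separating (inner u) (inner v) (u≢v ∘ ↑ʳ-injective r u v))
      hits : HitsPairs SC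
      hits c c′ c≢c′ = separates-clique-clique⁻ (separating (clique c) (clique c′) (c≢c′ ∘ ↑ˡ-injective n c c′))
      dominates : ∀ c → c ∉ SC → DominatesComplement H SH
      dominates c c∉SC h with separates-clique-inner⁻ (separating (clique c) (inner h) (clique≢inner c h))
      ... | inj₁ c∈SC = contradiction c∈SC c∉SC
      ... | inj₂ coDominated = coDominated

    clique∈⊎dominated : (∀ c → c ∉ SC → DominatesComplement H SH) →
                        ∀ c h → c ∈ SC ⊎ h ∈ SH ⊎ NonNeighbourIn H SH h
    clique∈⊎dominated dominates c h with c ∈? SC
    ... | yes c∈SC = inj₁ c∈SC
    ... | no c∉SC = inj₂ (dominates c c∉SC h)

    separating-join⁺ : Separating H SH → HitsPairs SC → (∀ c → c ∉ SC → DominatesComplement H SH) →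
                       Separating K+H (SC ++ SH)
    separating-join⁺ separatingH hits dominates x y x≢y with vertex x | vertex y
    ... | cliqueVertex c | cliqueVertex c′ = separates-clique-clique⁺ (hits c c′ (x≢y ∘ cong clique))
    ... | cliqueVertex c | innerVertex h = separates-clique-inner⁺ (clique∈⊎dominated dominates c h)
    ... | innerVertex h | cliqueVertex c =
          separates-sym K+H (separates-clique-inner⁺ (clique∈⊎dominated dominates c h))
    ... | innerVertex u | innerVertex v = separates-inner-inner⁺ (separatingH u v (x≢y ∘ cong inner))

-- A strong resolving set of K_{r+1} + H contains the whole clique (full) or all but one clique
-- vertex (cofull); its size is r plus the excess indexing JoinExcess.
data JoinExcess {n : ℕ} (H : Graph n) : ℕ → Set where
  full   : ∀ {SH} → Separating H SH → JoinExcess H (suc ∣ SH ∣)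
  cofull : ∀ {SH} → Separating H SH → DominatesComplement H SH → JoinExcess H ∣ SH ∣

MinimalExcess : ∀ {n} → Graph n → ℕ → Set
MinimalExcess H e = JoinExcess H e × ∀ e′ → JoinExcess H e′ → e ≤ e′

module _ {n : ℕ} (H : Graph n) (r : ℕ) where
  open Join H (suc r)

  diameter≤2-join : Diameter≤2 K+H
  diameter≤2-join = universal⇒diameter≤2 K+H (clique-universal zero)

  ∣⊤++q∣ : ∀ (q : Subset n) → ∣ ⊤ {suc r} ++ q ∣ ≡ r + suc ∣ q ∣
  ∣⊤++q∣ q = trans (∣++∣ (⊤ {suc r}) q) (trans (cong (_+ ∣ q ∣) (∣⊤∣≡n (suc r))) (sym (+-suc r ∣ q ∣)))

  ∣∁⁅x⁆++q∣ : ∀ (c : Fin (suc r)) (q : Subset n) → ∣ ∁ ⁅ c ⁆ ++ q ∣ ≡ r + ∣ q ∣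
  ∣∁⁅x⁆++q∣ c q = trans (∣++∣ (∁ ⁅ c ⁆) q) (cong (_+ ∣ q ∣) (∣∁⁅x⁆∣≡n∸1 c))

  resolving-join⇒excess : ∀ S → IsStrongResolvingSet K+H S → ∃[ e ] (JoinExcess H e × ∣ S ∣ ≡ r + e)
  resolving-join⇒excess S resolving with Vec.splitAt (suc r) S
  ... | SC , SH , refl with separating-join⁻ {SC} {SH} (resolving⇒separating K+H diameter≤2-join _ resolving)
  ... | separatingH , hits , dominates with hitsPairs⇒⊤⊎∁⁅x⁆ hits
  ...   | inj₁ refl = suc ∣ SH ∣ , full separatingH , ∣⊤++q∣ SH
  ...   | inj₂ (c , c∉SC , refl) = ∣ SH ∣ , cofull separatingH (dominates c c∉SC) , ∣∁⁅x⁆++q∣ c SH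

  excess⇒resolving-join : ∀ {e} → JoinExcess H e → ∃[ S ] (IsStrongResolvingSet K+H S × ∣ S ∣ ≡ r + e)
  excess⇒resolving-join (full {SH} separatingH) =
    ⊤ {suc r} ++ SH ,
    separating⇒resolving K+H diameter≤2-join _
      (separating-join⁺ separatingH (λ _ _ _ → inj₁ ∈⊤) (λ _ c∉⊤ → contradiction ∈⊤ c∉⊤)) ,
    ∣⊤++q∣ SH
  excess⇒resolving-join (cofull {SH} separatingH dominates) =
    ∁ ⁅ zero {r} ⁆ ++ SH ,
    separating⇒resolving K+H diameter≤2-join _
      (separating-join⁺ separatingH (hitsPairs-∁⁅x⁆ zero) (λ _ _ → dominates)) ,
    ∣∁⁅x⁆++q∣ zero SH

  minimalExcess⇒strongMetricDim : ∀ {e} → MinimalExcess H e → StrongMetricDim K+H (r + e)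
  minimalExcess⇒strongMetricDim (excess , minimal) = excess⇒resolving-join excess , lowerBound
    where
    lowerBound : ∀ S → IsStrongResolvingSet K+H S → r + _ ≤ ∣ S ∣
    lowerBound S resolving with resolving-join⇒excess S resolving
    ... | e′ , excess′ , ∣S∣≡r+e′ = subst (r + _ ≤_) (sym ∣S∣≡r+e′) (+-monoʳ-≤ r (minimal e′ excess′))

  strongMetricDim⇒minimalExcess : ∀ {d} → StrongMetricDim K+H d → ∃[ e ] (MinimalExcess H e × d ≡ r + e)
  strongMetricDim⇒minimalExcess ((S , resolving , ∣S∣≡d) , minimal) with resolving-join⇒excess S resolving
  ... | e , excess , ∣S∣≡r+e = e , (excess , lowerBound) , trans (sym ∣S∣≡d) ∣S∣≡r+e
    where
    lowerBound : ∀ e′ → JoinExcess H e′ → e ≤ e′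
    lowerBound e′ excess′ with excess⇒resolving-join excess′
    ... | S′ , resolving′ , ∣S′∣≡r+e′ =
      +-cancelˡ-≤ r _ _ (subst₂ _≤_ (trans (sym ∣S∣≡d) ∣S∣≡r+e) ∣S′∣≡r+e′ (minimal S′ resolving′))

module _ {n : ℕ} (H : Graph n) {k : ℕ} (dim : StrongMetricDim H k) where

  private
    separating⇒k≤ : Diameter≤2 H → ∀ {SH} → Separating H SH → k ≤ ∣ SH ∣
    separating⇒k≤ diameter≤2 {SH} separating =
      proj₂ dim SH (separating⇒resolving H diameter≤2 SH separating)

    minimalSeparating : Diameter≤2 H → ∃[ S ] (Separating H S × ∣ S ∣ ≡ k)
    minimalSeparating diameter≤2 with proj₁ dim
    ... | S , resolving , ∣S∣≡k = S , resolving⇒separating H diameter≤2 S resolving , ∣S∣≡k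

  -- a cofull set contains the universal vertex, and deleting it leaves a separating set
  universal⇒minimalExcess : ∀ {z} → Universal H z → MinimalExcess H (suc k)
  universal⇒minimalExcess universal = fullExcess , lowerBound
    where
    diameter≤2 : Diameter≤2 H
    diameter≤2 = universal⇒diameter≤2 H universal
    fullExcess : JoinExcess H (suc k)
    fullExcess with minimalSeparating diameter≤2
    ... | S , separating , refl = full separating
    lowerBound : ∀ e → JoinExcess H e → suc k ≤ e
    lowerBound _ (full separatingH) = s≤s (separating⇒k≤ diameter≤2 separatingH)
    lowerBound _ (cofull separatingH dominates) =
      ≤-trans (s≤s (separating⇒k≤ diameter≤2 (separating-deleteUniversal H universal dominates separatingH)))
              (x∈p⇒∣p-x∣<∣p∣ (dominatesComplement⇒universal∈ H universal dominates))

  nonUniversal⇒minimalExcess : Diameter≤2 H → (∀ h → ∃[ w ] (w ≢ h × adj H h w ≡ false)) → MinimalExcess H k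
  nonUniversal⇒minimalExcess diameter≤2 nonUniversal = cofullExcess , lowerBound
    where
    cofullExcess : JoinExcess H k
    cofullExcess with minimalSeparating diameter≤2
    ... | S , separating , refl = cofull separating (separating⇒dominatesComplement H nonUniversal separating)
    lowerBound : ∀ e → JoinExcess H e → k ≤ e
    lowerBound _ (full separatingH) = ≤-trans (separating⇒k≤ diameter≤2 separatingH) (n≤1+n _)
    lowerBound _ (cofull separatingH _) = separating⇒k≤ diameter≤2 separatingH

corollary11 : ∀ {n : ℕ} (H : Graph n) (r : ℕ) → 1 ≤ n → 1 ≤ r →
    ((maxDegree H ≡ n ∸ 1) →
      ∀ (k : ℕ) → StrongMetricDim H k → StrongMetricDim (complete r ⊕ H) (k + r))
    × ((maxDegree H ≤ n ∸ 2) → HasDiameter H 2 →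
      ∀ (k : ℕ) → StrongMetricDim H k → StrongMetricDim (complete r ⊕ H) (k + r ∸ 1))
    × ((¬ Connected H ⊎ (Connected H × ∃[ d ] (HasDiameter H d × 2 < d))) →
      ∀ (k : ℕ) → StrongMetricDim (complete 1 ⊕ H) k → StrongMetricDim (complete r ⊕ H) (k + r ∸ 1))
corollary11 {n} H (suc r) 1≤n (s≤s z≤n) = universalCase , diameterTwoCase , generalCase
  where
  r+k≡k+r+1∸1 : ∀ k → r + k ≡ k + suc r ∸ 1
  r+k≡k+r+1∸1 k = trans (+-comm r k) (cong (_∸ 1) (sym (+-suc k r)))

  universalCase : maxDegree H ≡ n ∸ 1 →
                  ∀ k → StrongMetricDim H k → StrongMetricDim (complete (suc r) ⊕ H) (k + suc r)
  universalCase maxDegree≡n∸1 k dim with maxDegree-attained H (fromℕ< 1≤n)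
  ... | z , maxDegree≤degree =
    subst (StrongMetricDim _) (trans (+-comm r (suc k)) (sym (+-suc k r)))
          (minimalExcess⇒strongMetricDim H r (universal⇒minimalExcess H dim universal))
    where
    universal : Universal H z
    universal = n∸1≤degree⇒universal H (subst (_≤ degree H z) maxDegree≡n∸1 maxDegree≤degree)

  diameterTwoCase : maxDegree H ≤ n ∸ 2 → HasDiameter H 2 →
                    ∀ k → StrongMetricDim H k → StrongMetricDim (complete (suc r) ⊕ H) (k + suc r ∸ 1)
  diameterTwoCase maxDegree≤n∸2 diameter2 k dim =
    subst (StrongMetricDim _) (r+k≡k+r+1∸1 k)
          (minimalExcess⇒strongMetricDim H r
            (nonUniversal⇒minimalExcess H dim (hasDiameter2⇒diameter≤2 H diameter2) nonUniversal))
    where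
    nonUniversal : ∀ h → ∃[ w ] (w ≢ h × adj H h w ≡ false)
    nonUniversal h = degree≤n∸2⇒nonNeighbour H (hasDiameter2⇒2≤order H diameter2)
                                              (≤-trans (degree≤maxDegree H h) maxDegree≤n∸2)

  generalCase : (¬ Connected H ⊎ (Connected H × ∃[ d ] (HasDiameter H d × 2 < d))) →
                ∀ k → StrongMetricDim (complete 1 ⊕ H) k →
                StrongMetricDim (complete (suc r) ⊕ H) (k + suc r ∸ 1)
  generalCase _ k dim with strongMetricDim⇒minimalExcess H 0 dim
  ... | e , minimal , refl =
    subst (StrongMetricDim _) (r+k≡k+r+1∸1 e) (minimalExcess⇒strongMetricDim H r minimal)
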